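{- Let $m$ and $n$ be powers of $2$ with $m \geq 16$, $n \geq 4$ and $m \leq 4n$, and let $$G(m,n) = \langle a, b \mid a^m = 1,\ b^n = 1,\ [b,a] = a^4 \rangle .$$ Then $G(m,n)$ does not embed as a subgroup of index $2$ in any group generated by elements of order $2$. Consequently, there are infinitely many finite $2$-groups that do not embed as a subgroup of index $2$ in any group generated by elements of order $2$.
   Context: The commutator convention is $[x,y] = x^{ -1}y^{ -1}xy$ (so that $[xy,z] = [x,z]^y[y,z]$, where $g^y = y^{ -1}gy$). An involution is an element of order $2$. -}

module Defs where

open import Level using (Level; 0ℓ; _⊔_) renaming (suc to lsuc)
open import Data.Nat using (ℕ; zero; suc; _^_)
open import Data.Fin using (Fin)
open import Data.Product using (Σ; _×_; _,_)
open import Data.Sum using (_⊎_)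
open import Data.List using (List; foldr)
open import Data.List.Relation.Unary.All using (All)
open import Relation.Nullary using (¬_)
open import Relation.Binary.PropositionalEquality using (_≡_)
open import Algebra.Bundles using (Group)
open import Algebra.Morphism.Structures using (IsGroupMonomorphism)

IsPowerOf2 : ℕ → Set
IsPowerOf2 m = Σ ℕ λ k → m ≡ 2 ^ k

-- Commutator convention: [x,y] = x⁻¹ y⁻¹ x y.

infixl 7 _·_

data Term : Set where
  gen-a gen-b one : Term
  _·_ : Term → Term → Term
  inv : Term → Term

pow : Term → ℕ → Term
pow t zero    = one
pow t (suc k) = t · pow t k

comm : Term → Term → Term
comm x y = inv x · inv y · x · y

module Presentation (m n : ℕ) where

  infix 4 _~_
  data _~_ : Term → Term → Set where
    ~-refl  : ∀ {x} → x ~ x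
    ~-sym   : ∀ {x y} → x ~ y → y ~ x
    ~-trans : ∀ {x y z} → x ~ y → y ~ z → x ~ z
    ~-cong· : ∀ {x y u v} → x ~ y → u ~ v → x · u ~ y · v
    ~-cong⁻¹ : ∀ {x y} → x ~ y → inv x ~ inv y
    ~-assoc : ∀ x y z → (x · y) · z ~ x · (y · z)
    ~-idˡ   : ∀ x → one · x ~ x
    ~-idʳ   : ∀ x → x · one ~ x
    ~-invˡ  : ∀ x → inv x · x ~ one
    ~-invʳ  : ∀ x → x · inv x ~ one
    rel-a   : pow gen-a m ~ one
    rel-b   : pow gen-b n ~ one
    rel-ba  : comm gen-b gen-a ~ pow gen-a 4

  G : Group 0ℓ 0ℓ
  G = record
    { Carrier = Term
    ; _≈_ = _~_
    ; _∙_ = _·_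
    ; ε = one
    ; _⁻¹ = inv
    ; isGroup = record
      { isMonoid = record
        { isSemigroup = record
          { isMagma = record
            { isEquivalence = record { refl = ~-refl ; sym = ~-sym ; trans = ~-trans }
            ; ∙-cong = ~-cong· }
          ; assoc = ~-assoc }
        ; identity = ~-idˡ , ~-idʳ }
      ; inverse = ~-invˡ , ~-invʳ
      ; ⁻¹-cong = ~-cong⁻¹ } }

G[_,_] : ℕ → ℕ → Group 0ℓ 0ℓ
G[ m , n ] = Presentation.G m n

module _ {c ℓ : Level} (H : Group c ℓ) where
  open Group H

  IsInvolution : Carrier → Set ℓ
  IsInvolution x = ¬ (x ≈ ε) × (x ∙ x ≈ ε)

  -- every element is a finite product of involutions (involutions are
  -- self-inverse, so this is the subgroup generated by them)
  GeneratedByInvolutions : Set (c ⊔ ℓ)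
  GeneratedByInvolutions =
    ∀ h → Σ (List Carrier) λ xs → All IsInvolution xs × (h ≈ foldr _∙_ ε xs)

  HasOrder : ℕ → Set (c ⊔ ℓ)
  HasOrder k = Σ (Fin k → Carrier) λ e →
    (∀ i j → e i ≈ e j → i ≡ j) × (∀ x → Σ (Fin k) λ i → e i ≈ x)

module _ {a b c ℓ : Level} (K : Group a b) (H : Group c ℓ) where
  private
    module K = Group K
    module H = Group H

  InImage : (K.Carrier → H.Carrier) → H.Carrier → Set (a ⊔ ℓ)
  InImage f h = Σ K.Carrier λ g → f g H.≈ h

  -- f is an injective homomorphism whose image has exactly two left
  -- cosets: the image itself and t·image for some t outside it.
  EmbedsWithIndex2 : Set (a ⊔ b ⊔ c ⊔ ℓ)
  EmbedsWithIndex2 = Σ (K.Carrier → H.Carrier) λ f →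
    IsGroupMonomorphism K.rawGroup H.rawGroup f ×
    Σ H.Carrier λ t → ¬ InImage f t ×
      (∀ h → InImage f h ⊎ InImage f ((t H.⁻¹) H.∙ h))

NotIndex2InInvolutionGenerated : (c ℓ : Level) {a b : Level} → Group a b → Set (lsuc (c ⊔ ℓ) ⊔ a ⊔ b)
NotIndex2InInvolutionGenerated c ℓ K =
  (H : Group c ℓ) → GeneratedByInvolutions H → ¬ EmbedsWithIndex2 K H

{-# OPTIONS --safe #-}
-- Suppose K has index 2 in a group H generated by involutions. Some generating
-- involution s of H lies outside K, and conjugation by s restricts to an involutive
-- automorphism σ of K. As H = K ∪ sK, every element of K is a product of elements k
-- with k² = 1 or σ(k) k = 1.
--
-- Map K = G(m,n) onto R = ℤ/16 ⋊ ℤ/4 and then onto its abelianization Q = (ℤ/4)².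
-- K is generated by a and b modulo its centre, and central elements die in Q, so σ
-- induces a linear map M of Q. Involutions of R land in 2Q, and σ(k) k = 1 puts the
-- image of k in ker(M + 1); hence Q = ker(M + 1) + 2Q, which forces M = −1. So the
-- images x, y ∈ R of σ(a), σ(b) reduce to −e₁, −e₂ in Q and satisfy [y, x] = x⁴,
-- which no such pair in R does.

module Submission where

open import Defs
open import Level using (0ℓ; _⊔_)
open import Data.Bool using (Bool; true; _∧_; T)
open import Data.Bool.Properties using (T-≡; T-∧; xor-∧-commutativeRing)
open import Data.Empty using (⊥; ⊥-elim)
open import Data.Fin using (Fin; toℕ; #_; combine; remQuot)
open import Data.Fin.Properties using (combine-remQuot; remQuot-combine; 2↔Bool; *↔×)
  renaming (_≟_ to _≟ᶠ_)
open import Data.List using ([]; _∷_; foldr)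
open import Data.List.Relation.Unary.All using (All; []; _∷_)
open import Data.Nat using (ℕ; zero; suc; _+_; _*_; _∸_; _^_; _≤_; z≤n; s≤s)
open import Data.Nat.Divisibility using (_∣_; divides; m∣m*n)
open import Data.Nat.DivMod using (_mod_)
open import Data.Nat.Properties
  using (_≤?_; ≰⇒>; <⇒≱; ^-monoʳ-<; ^-distribˡ-+-*; m≤n⇒∃[o]m+o≡n; m≤n+m)
open import Data.Product using (Σ; _×_; _,_; proj₁; proj₂; map)
open import Data.Product.Properties using (≡-dec)
open import Data.Sum using (_⊎_; inj₁; inj₂)
open import Function using (_∘_; id; Equivalence; _↔_; Inverse)
open import Relation.Nullary using (Dec; yes; no; ¬_)
open import Relation.Nullary.Decidable using (⌊_⌋; toWitness; _→-dec_; ¬?)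
open import Relation.Binary.PropositionalEquality as ≡ using (_≡_)
import Relation.Binary.Reasoning.Setoid as SetoidReasoning
open import Algebra.Bundles using (Group; AbelianGroup; CommutativeRing)
open import Algebra.Morphism.Structures using (IsGroupHomomorphism; IsGroupMonomorphism)
import Algebra.Construct.DirectProduct as DirectProduct
import Algebra.Construct.Terminal as Terminal
import Algebra.Morphism.Construct.Composition as Composition
import Algebra.Properties.CommutativeSemigroup as CommutativeSemigroupProperties
import Algebra.Properties.Group as GroupProperties

record Searchable (A : Set) : Set where
  field
    allᵇ       : (A → Bool) → Bool
    allᵇ-sound : ∀ p → T (allᵇ p) → ∀ x → T (p x)

open Searchable ⦃ … ⦄

allFinᵇ : ∀ n → (Fin n → Bool) → Bool
allFinᵇ zero    p = true
allFinᵇ (suc n) p = p Fin.zero ∧ allFinᵇ n (p ∘ Fin.suc)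

allFinᵇ-sound : ∀ n p → T (allFinᵇ n p) → ∀ i → T (p i)
allFinᵇ-sound (suc n) p ok Fin.zero    = proj₁ (Equivalence.to T-∧ ok)
allFinᵇ-sound (suc n) p ok (Fin.suc i) = allFinᵇ-sound n (p ∘ Fin.suc) (proj₂ (Equivalence.to T-∧ ok)) i

instance
  Fin-searchable : ∀ {n} → Searchable (Fin n)
  Fin-searchable {n} = record { allᵇ = allFinᵇ n ; allᵇ-sound = allFinᵇ-sound n }

  ×-searchable : ∀ {A B} → ⦃ Searchable A ⦄ → ⦃ Searchable B ⦄ → Searchable (A × B)
  ×-searchable = record
    { allᵇ       = λ p → allᵇ λ a → allᵇ λ b → p (a , b)
    ; allᵇ-sound = λ p ok (a , b) → allᵇ-sound _ (allᵇ-sound _ ok a) b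
    }

-- Checks are stated as `b ≡ true` and closed by refl: leaving `T b` to be solved
-- by unification evaluates b far more slowly.
decide : ∀ {A} ⦃ _ : Searchable A ⦄ {P : A → Set} (P? : ∀ x → Dec (P x)) →
         allᵇ (⌊_⌋ ∘ P?) ≡ true → ∀ x → P x
decide P? ok x = toWitness {a? = P? x} (allᵇ-sound (⌊_⌋ ∘ P?) (Equivalence.from T-≡ ok) x)

decide₂ : ∀ {A B} ⦃ _ : Searchable A ⦄ ⦃ _ : Searchable B ⦄ {P : A → B → Set} (P? : ∀ x y → Dec (P x y)) →
          allᵇ (λ (x , y) → ⌊ P? x y ⌋) ≡ true → ∀ x y → P x y
decide₂ P? ok x y = decide (λ (x , y) → P? x y) ok (x , y)

decide₃ : ∀ {A B C} ⦃ _ : Searchable A ⦄ ⦃ _ : Searchable B ⦄ ⦃ _ : Searchable C ⦄ {P : A → B → C → Set}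
          (P? : ∀ x y z → Dec (P x y z)) →
          allᵇ (λ (x , y , z) → ⌊ P? x y z ⌋) ≡ true → ∀ x y z → P x y z
decide₃ P? ok x y z = decide (λ (x , y , z) → P? x y z) ok (x , y , z)

powerOf2-≤⇒∣ : ∀ i {m} → IsPowerOf2 m → 2 ^ i ≤ m → 2 ^ i ∣ m
powerOf2-≤⇒∣ i (k , ≡.refl) 2^i≤2^k with i ≤? k
... | no i≰k = ⊥-elim (<⇒≱ (^-monoʳ-< 2 (s≤s (s≤s z≤n)) (≰⇒> i≰k)) 2^i≤2^k)
... | yes i≤k with o , i+o≡k ← m≤n⇒∃[o]m+o≡n i≤k =
  ≡.subst (2 ^ i ∣_) (≡.trans (≡.sym (^-distribˡ-+-* 2 i o)) (≡.cong (2 ^_) i+o≡k)) (m∣m*n (2 ^ o))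

module _ {c₁ ℓ₁ c₂ ℓ₂} (G : Group c₁ ℓ₁) (H : Group c₂ ℓ₂) where
  private
    module G = Group G
    module H = Group H
  open GroupProperties H using (identityˡ-unique; inverseˡ-unique)

  ∙-homo⇒isGroupHomomorphism : ∀ {f} → (∀ {x y} → x G.≈ y → f x H.≈ f y) →
                               (∀ x y → f (x G.∙ y) H.≈ f x H.∙ f y) →
                               IsGroupHomomorphism G.rawGroup H.rawGroup f
  ∙-homo⇒isGroupHomomorphism {f} f-cong f-homo = record
    { isMonoidHomomorphism = record
      { isMagmaHomomorphism = record
        { isRelHomomorphism = record { cong = f-cong }
        ; homo              = f-homo
        }
      ; ε-homo = ε-homo
      }
    ; ⁻¹-homo = λ x → inverseˡ-unique _ _
        (H.trans (H.sym (f-homo _ _)) (H.trans (f-cong (G.inverseˡ x)) ε-homo))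
    }
    where
    ε-homo : f G.ε H.≈ H.ε
    ε-homo = identityˡ-unique _ _ (H.trans (H.sym (f-homo _ _)) (f-cong (G.identityˡ G.ε)))

module _ {c ℓ} (G : Group c ℓ) where
  open Group G

  eval : Carrier → Carrier → Term → Carrier
  eval x y gen-a   = x
  eval x y gen-b   = y
  eval x y one     = ε
  eval x y (u · v) = eval x y u ∙ eval x y v
  eval x y (inv u) = eval x y u ⁻¹

  Central : Carrier → Set (c ⊔ ℓ)
  Central z = ∀ y → z ∙ y ≈ y ∙ z

  GeneratedModuloCentre : Carrier → Carrier → Set (c ⊔ ℓ)
  GeneratedModuloCentre a b =
    ∀ g → Σ Term λ w → Σ Carrier λ z → Central z × g ≈ eval a b w ∙ z

  eval-cong : ∀ {x x′ y y′} → x ≈ x′ → y ≈ y′ → ∀ w → eval x y w ≈ eval x′ y′ w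
  eval-cong x≈ y≈ gen-a   = x≈
  eval-cong x≈ y≈ gen-b   = y≈
  eval-cong x≈ y≈ one     = refl
  eval-cong x≈ y≈ (u · v) = ∙-cong (eval-cong x≈ y≈ u) (eval-cong x≈ y≈ v)
  eval-cong x≈ y≈ (inv u) = ⁻¹-cong (eval-cong x≈ y≈ u)

  eval-pow-+ : ∀ x y t k l → eval x y (pow t (k + l)) ≈ eval x y (pow t k) ∙ eval x y (pow t l)
  eval-pow-+ x y t zero    l = sym (identityˡ _)
  eval-pow-+ x y t (suc k) l = trans (∙-congˡ (eval-pow-+ x y t k l)) (sym (assoc _ _ _))

  eval-pow-*-ε : ∀ {x y t k} → eval x y (pow t k) ≈ ε → ∀ d → eval x y (pow t (d * k)) ≈ ε
  eval-pow-*-ε t^k≈ε zero    = refl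
  eval-pow-*-ε {x} {y} {t} {k} t^k≈ε (suc d) = begin
    eval x y (pow t (k + d * k))                   ≈⟨ eval-pow-+ x y t k (d * k) ⟩
    eval x y (pow t k) ∙ eval x y (pow t (d * k))  ≈⟨ ∙-cong t^k≈ε (eval-pow-*-ε t^k≈ε d) ⟩
    ε ∙ ε                                          ≈⟨ identityˡ ε ⟩
    ε                                              ∎
    where open SetoidReasoning setoid

module _ {c₁ ℓ₁ c₂ ℓ₂} {G : Group c₁ ℓ₁} {H : Group c₂ ℓ₂} {f}
         (f-hom : IsGroupHomomorphism (Group.rawGroup G) (Group.rawGroup H) f) where
  open Group H
  open IsGroupHomomorphism f-hom

  eval-homo : ∀ x y w → f (eval G x y w) ≈ eval H (f x) (f y) w
  eval-homo x y gen-a   = refl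
  eval-homo x y gen-b   = refl
  eval-homo x y one     = ε-homo
  eval-homo x y (u · v) = trans (homo _ _) (∙-cong (eval-homo x y u) (eval-homo x y v))
  eval-homo x y (inv u) = trans (⁻¹-homo _) (⁻¹-cong (eval-homo x y u))

module _ {c ℓ} {K : Group c ℓ} {σ}
         (σ-hom : IsGroupHomomorphism (Group.rawGroup K) (Group.rawGroup K) σ) where
  open Group K
  open IsGroupHomomorphism σ-hom
  open SetoidReasoning setoid

  involutive-homo-central : (∀ k → σ (σ k) ≈ k) → ∀ z → Central K z → Central K (σ z)
  involutive-homo-central σ-involutive z z-central y = begin
    σ z ∙ y            ≈⟨ ∙-congˡ (σ-involutive y) ⟨
    σ z ∙ σ (σ y)      ≈⟨ homo z (σ y) ⟨
    σ (z ∙ σ y)        ≈⟨ ⟦⟧-cong (z-central (σ y)) ⟩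
    σ (σ y ∙ z)        ≈⟨ homo (σ y) z ⟩
    σ (σ y) ∙ σ z      ≈⟨ ∙-congʳ (σ-involutive y) ⟩
    y ∙ σ z            ∎

module _ {c₁ ℓ₁ c₂ ℓ₂} {K : Group c₁ ℓ₁} {X : Group c₂ ℓ₂} {φ χ}
         (φ-hom : IsGroupHomomorphism (Group.rawGroup K) (Group.rawGroup X) φ)
         (χ-hom : IsGroupHomomorphism (Group.rawGroup K) (Group.rawGroup X) χ) where
  private
    module K = Group K
    module φ = IsGroupHomomorphism φ-hom
    module χ = IsGroupHomomorphism χ-hom
  open Group X
  open SetoidReasoning setoid

  homomorphisms-agree : ∀ {a b} → GeneratedModuloCentre K a b → φ a ≈ χ a → φ b ≈ χ b →
                        (∀ z → Central K z → φ z ≈ χ z) → ∀ g → φ g ≈ χ g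
  homomorphisms-agree {a} {b} generated φa≈χa φb≈χb centre≈ g
    with w , z , z-central , g≈ ← generated g = begin
      φ g                           ≈⟨ φ.⟦⟧-cong g≈ ⟩
      φ (eval K a b w K.∙ z)        ≈⟨ φ.homo _ _ ⟩
      φ (eval K a b w) ∙ φ z        ≈⟨ ∙-cong (eval-homo φ-hom a b w) (centre≈ z z-central) ⟩
      eval X (φ a) (φ b) w ∙ χ z    ≈⟨ ∙-congʳ (eval-cong X φa≈χa φb≈χb w) ⟩
      eval X (χ a) (χ b) w ∙ χ z    ≈⟨ ∙-congʳ (eval-homo χ-hom a b w) ⟨
      χ (eval K a b w) ∙ χ z        ≈⟨ χ.homo _ _ ⟨
      χ (eval K a b w K.∙ z)        ≈⟨ χ.⟦⟧-cong g≈ ⟨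
      χ g                           ∎

module _ {c ℓ} (X : Group c ℓ) {m n : ℕ} {x y : Group.Carrier X} where
  open Group X
  open Presentation m n

  module _ (x^m≈ε : eval X x y (pow gen-a m) ≈ ε) (y^n≈ε : eval X x y (pow gen-b n) ≈ ε)
           (relation : eval X x y (comm gen-b gen-a) ≈ eval X x y (pow gen-a 4)) where

    eval-cong-~ : ∀ {u v} → u ~ v → eval X x y u ≈ eval X x y v
    eval-cong-~ ~-refl           = refl
    eval-cong-~ (~-sym e)        = sym (eval-cong-~ e)
    eval-cong-~ (~-trans e e′)   = trans (eval-cong-~ e) (eval-cong-~ e′)
    eval-cong-~ (~-cong· e e′)   = ∙-cong (eval-cong-~ e) (eval-cong-~ e′)
    eval-cong-~ (~-cong⁻¹ e)     = ⁻¹-cong (eval-cong-~ e)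
    eval-cong-~ (~-assoc u v w)  = assoc _ _ _
    eval-cong-~ (~-idˡ u)        = identityˡ _
    eval-cong-~ (~-idʳ u)        = identityʳ _
    eval-cong-~ (~-invˡ u)       = inverseˡ _
    eval-cong-~ (~-invʳ u)       = inverseʳ _
    eval-cong-~ rel-a            = x^m≈ε
    eval-cong-~ rel-b            = y^n≈ε
    eval-cong-~ rel-ba           = relation

    eval-isGroupHomomorphism : IsGroupHomomorphism (Group.rawGroup G[ m , n ]) rawGroup (eval X x y)
    eval-isGroupHomomorphism = record
      { isMonoidHomomorphism = record
        { isMagmaHomomorphism = record
          { isRelHomomorphism = record { cong = eval-cong-~ }
          ; homo              = λ _ _ → refl
          }
        ; ε-homo = refl
        }
      ; ⁻¹-homo = λ _ → refl
      }

eval-generators : ∀ {m n} w → Presentation._~_ m n (eval G[ m , n ] gen-a gen-b w) w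
eval-generators gen-a   = Presentation.~-refl
eval-generators gen-b   = Presentation.~-refl
eval-generators one     = Presentation.~-refl
eval-generators (u · v) = Presentation.~-cong· (eval-generators u) (eval-generators v)
eval-generators (inv u) = Presentation.~-cong⁻¹ (eval-generators u)

HasOrder-↔ : ∀ {c ℓ} (G : Group c ℓ) {k} (e : Fin k ↔ Group.Carrier G) →
             (∀ {x y} → Group._≈_ G x y → x ≡ y) → HasOrder G k
HasOrder-↔ G e ≈⇒≡ =
  to ,
  (λ i j eq → ≡.trans (≡.sym (strictlyInverseʳ i)) (≡.trans (≡.cong from (≈⇒≡ eq)) (strictlyInverseʳ j))) ,
  (λ x → from x , Group.reflexive G (strictlyInverseˡ x))
  where open Inverse e

HasOrder-× : ∀ {c₁ ℓ₁ c₂ ℓ₂} (G : Group c₁ ℓ₁) (H : Group c₂ ℓ₂) {m n} →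
             HasOrder G m → HasOrder H n → HasOrder (DirectProduct.group G H) (m * n)
HasOrder-× G H {m} {n} (e₁ , e₁-injective , e₁-surjective) (e₂ , e₂-injective , e₂-surjective) =
  e , injective , surjective
  where
  module G×H = Group (DirectProduct.group G H)

  e : Fin (m * n) → G×H.Carrier
  e = map e₁ e₂ ∘ remQuot n

  injective : ∀ i j → e i G×H.≈ e j → i ≡ j
  injective i j (≈₁ , ≈₂) = ≡.trans (≡.sym (combine-remQuot {m} n i))
    (≡.trans (≡.cong₂ combine (e₁-injective _ _ ≈₁) (e₂-injective _ _ ≈₂)) (combine-remQuot {m} n j))

  surjective : ∀ x → Σ (Fin (m * n)) λ i → e i G×H.≈ x
  surjective (x₁ , x₂) with i₁ , ≈₁ ← e₁-surjective x₁ | i₂ , ≈₂ ← e₂-surjective x₂ =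
    combine i₁ i₂ , G×H.trans (G×H.reflexive (≡.cong (map e₁ e₂) (remQuot-combine i₁ i₂))) (≈₁ , ≈₂)

module Index2 {k₁ k₂ c ℓ} {K : Group k₁ k₂} {H : Group c ℓ}
              (generated : GeneratedByInvolutions H) (embedding : EmbedsWithIndex2 K H) where
  open Group H
  open GroupProperties H
  open SetoidReasoning setoid
  private
    module K = Group K
    module KP = GroupProperties K

    f : K.Carrier → Carrier
    f = proj₁ embedding
    module f = IsGroupMonomorphism (proj₁ (proj₂ embedding))

    t : Carrier
    t = proj₁ (proj₂ (proj₂ embedding))

    t∉ : ¬ InImage K H f t
    t∉ = proj₁ (proj₂ (proj₂ (proj₂ embedding)))

    t-cosets : ∀ h → InImage K H f h ⊎ InImage K H f (t \\ h)
    t-cosets = proj₂ (proj₂ (proj₂ (proj₂ embedding)))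

  Image : Carrier → Set (k₁ ⊔ ℓ)
  Image = InImage K H f

  image-cong : ∀ {x y} → x ≈ y → Image x → Image y
  image-cong x≈y (g , fg≈x) = g , trans fg≈x x≈y

  image-ε : Image ε
  image-ε = K.ε , f.ε-homo

  image-∙ : ∀ {x y} → Image x → Image y → Image (x ∙ y)
  image-∙ (g , fg≈x) (h , fh≈y) = g K.∙ h , trans (f.∙-homo g h) (∙-cong fg≈x fh≈y)

  image-⁻¹ : ∀ {x} → Image x → Image (x ⁻¹)
  image-⁻¹ (g , fg≈x) = g K.⁻¹ , trans (f.⁻¹-homo g) (⁻¹-cong fg≈x)

  image? : ∀ h → Image h ⊎ ¬ Image h
  image? h with t-cosets h
  ... | inj₁ h∈ = inj₁ h∈
  ... | inj₂ t\\h∈ = inj₂ λ h∈ →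
    t∉ (image-cong (\\-leftDividesˡ h t) (image-∙ h∈ (image-cong (⁻¹-anti-homo-\\ t h) (image-⁻¹ t\\h∈))))

  involution-outside : Σ Carrier λ s → IsInvolution H s × ¬ Image s
  involution-outside with generated t
  ... | xs , involutions , t≈ = search xs involutions λ ∏xs∈ → t∉ (image-cong (sym t≈) ∏xs∈)
    where
    search : ∀ xs → All (IsInvolution H) xs → ¬ Image (foldr _∙_ ε xs) →
             Σ Carrier λ s → IsInvolution H s × ¬ Image s
    search []       []       ∏∉ = ⊥-elim (∏∉ image-ε)
    search (x ∷ xs) (ix ∷ ixs) ∏∉ with image? x
    ... | inj₁ x∈ = search xs ixs λ ∏xs∈ → ∏∉ (image-∙ x∈ ∏xs∈)
    ... | inj₂ x∉ = x , ix , x∉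

  private
    s : Carrier
    s = proj₁ involution-outside

    s∙s≈ε : s ∙ s ≈ ε
    s∙s≈ε = proj₂ (proj₁ (proj₂ involution-outside))

    s∉ : ¬ Image s
    s∉ = proj₂ (proj₂ involution-outside)

    s≈s⁻¹ : s ≈ s ⁻¹
    s≈s⁻¹ = inverseʳ-unique s s s∙s≈ε

    s-cancel : ∀ x → s ∙ (s ∙ x) ≈ x
    s-cancel x = trans (∙-congʳ s≈s⁻¹) (\\-leftDividesʳ s x)

    s-cosets : ∀ h → Image h ⊎ Image (s ∙ h)
    s-cosets h with t-cosets h | t-cosets s
    ... | inj₁ h∈     | _           = inj₁ h∈
    ... | inj₂ _      | inj₁ s∈     = ⊥-elim (s∉ s∈)
    ... | inj₂ t\\h∈ | inj₂ t\\s∈ = inj₂ (image-cong s\\h≈ (image-∙ (image-⁻¹ t\\s∈) t\\h∈))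
      where
      s\\h≈ : (t \\ s) ⁻¹ ∙ (t \\ h) ≈ s ∙ h
      s\\h≈ = begin
        (t \\ s) ⁻¹ ∙ (t \\ h)  ≈⟨ ∙-congʳ (⁻¹-anti-homo-\\ t s) ⟩
        (s \\ t) ∙ (t \\ h)     ≈⟨ assoc _ _ _ ⟩
        s ⁻¹ ∙ (t ∙ (t \\ h))    ≈⟨ ∙-congˡ (\\-leftDividesˡ t h) ⟩
        s ⁻¹ ∙ h                 ≈⟨ ∙-congʳ s≈s⁻¹ ⟨
        s ∙ h                    ∎

    conj : Carrier → Carrier
    conj x = s ∙ (x ∙ s)

    conj-∙ : ∀ x y → conj (x ∙ y) ≈ conj x ∙ conj y
    conj-∙ x y = sym (begin
      (s ∙ (x ∙ s)) ∙ (s ∙ (y ∙ s))  ≈⟨ assoc _ _ _ ⟩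
      s ∙ ((x ∙ s) ∙ (s ∙ (y ∙ s)))  ≈⟨ ∙-congˡ (assoc _ _ _) ⟩
      s ∙ (x ∙ (s ∙ (s ∙ (y ∙ s))))  ≈⟨ ∙-congˡ (∙-congˡ (s-cancel _)) ⟩
      s ∙ (x ∙ (y ∙ s))              ≈⟨ ∙-congˡ (assoc _ _ _) ⟨
      s ∙ ((x ∙ y) ∙ s)              ∎)

    conj-conj : ∀ x → conj (conj x) ≈ x
    conj-conj x = begin
      s ∙ ((s ∙ (x ∙ s)) ∙ s)  ≈⟨ ∙-congˡ (assoc _ _ _) ⟩
      s ∙ (s ∙ ((x ∙ s) ∙ s))  ≈⟨ s-cancel _ ⟩
      (x ∙ s) ∙ s              ≈⟨ assoc _ _ _ ⟩
      x ∙ (s ∙ s)              ≈⟨ ∙-congˡ s∙s≈ε ⟩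
      x ∙ ε                    ≈⟨ identityʳ x ⟩
      x                        ∎

    conj-image : ∀ k → Image (conj (f k))
    conj-image k with s-cosets (conj (f k))
    ... | inj₁ conj∈   = conj∈
    ... | inj₂ s∙conj∈ = ⊥-elim (s∉ (image-cong (\\-leftDividesʳ (f k) s)
                           (image-∙ (image-⁻¹ (k , refl)) (image-cong (s-cancel _) s∙conj∈))))

  σ : K.Carrier → K.Carrier
  σ k = proj₁ (conj-image k)

  private
    f∘σ : ∀ k → f (σ k) ≈ conj (f k)
    f∘σ k = proj₂ (conj-image k)

    σ-cong : ∀ {x y} → x K.≈ y → σ x K.≈ σ y
    σ-cong x≈y = f.injective (trans (f∘σ _) (trans (∙-congˡ (∙-congʳ (f.⟦⟧-cong x≈y))) (sym (f∘σ _))))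

    σ-homo : ∀ x y → σ (x K.∙ y) K.≈ σ x K.∙ σ y
    σ-homo x y = f.injective (begin
      f (σ (x K.∙ y))          ≈⟨ f∘σ _ ⟩
      conj (f (x K.∙ y))       ≈⟨ ∙-congˡ (∙-congʳ (f.∙-homo x y)) ⟩
      conj (f x ∙ f y)         ≈⟨ conj-∙ _ _ ⟩
      conj (f x) ∙ conj (f y)  ≈⟨ ∙-cong (f∘σ x) (f∘σ y) ⟨
      f (σ x) ∙ f (σ y)        ≈⟨ f.∙-homo _ _ ⟨
      f (σ x K.∙ σ y)          ∎)

  σ-isGroupHomomorphism : IsGroupHomomorphism K.rawGroup K.rawGroup σ
  σ-isGroupHomomorphism = ∙-homo⇒isGroupHomomorphism K K σ-cong σ-homo

  σ-involutive : ∀ k → σ (σ k) K.≈ k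
  σ-involutive k = f.injective (begin
    f (σ (σ k))       ≈⟨ f∘σ (σ k) ⟩
    conj (f (σ k))    ≈⟨ ∙-congˡ (∙-congʳ (f∘σ k)) ⟩
    conj (conj (f k)) ≈⟨ conj-conj (f k) ⟩
    f k               ∎)

  Generator : K.Carrier → Set k₂
  Generator k = k K.∙ k K.≈ K.ε ⊎ σ k K.∙ k K.≈ K.ε

  private
    module σ = IsGroupHomomorphism σ-isGroupHomomorphism

    σ-generator : ∀ {k} → Generator k → Generator (σ k)
    σ-generator {k} (inj₁ k∙k≈ε)  = inj₁ (K.trans (K.sym (σ.homo k k)) (K.trans (σ-cong k∙k≈ε) σ.ε-homo))
    σ-generator {k} (inj₂ σk∙k≈ε) = inj₂ (K.trans (K.∙-congʳ (σ-involutive k))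
      (K.trans (K.∙-congˡ (KP.inverseˡ-unique (σ k) k σk∙k≈ε)) (K.inverseʳ k)))

    s-pair : ∀ k y → (s ∙ f k) ∙ (s ∙ y) ≈ f (σ k) ∙ y
    s-pair k y = begin
      (s ∙ f k) ∙ (s ∙ y)  ≈⟨ assoc _ _ _ ⟩
      s ∙ (f k ∙ (s ∙ y))  ≈⟨ ∙-congˡ (assoc _ _ _) ⟨
      s ∙ ((f k ∙ s) ∙ y)  ≈⟨ assoc _ _ _ ⟨
      conj (f k) ∙ y       ≈⟨ ∙-congʳ (f∘σ k) ⟨
      f (σ k) ∙ y          ∎

    conj-swap : ∀ k y → f k ∙ (s ∙ y) ≈ s ∙ (f (σ k) ∙ y)
    conj-swap k y = begin
      f k ∙ (s ∙ y)              ≈⟨ s-cancel _ ⟨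
      s ∙ (s ∙ (f k ∙ (s ∙ y)))  ≈⟨ ∙-congˡ (assoc _ _ _) ⟨
      s ∙ ((s ∙ f k) ∙ (s ∙ y))  ≈⟨ ∙-congˡ (s-pair k y) ⟩
      s ∙ (f (σ k) ∙ y)          ∎

    involution-shape : ∀ {x} → IsInvolution H x →
                       Σ K.Carrier λ k → Generator k × (x ≈ f k ⊎ x ≈ s ∙ f k)
    involution-shape {x} (_ , x∙x≈ε) with s-cosets x
    ... | inj₁ (k , fk≈x) = k , inj₁ (f.injective (begin
      f (k K.∙ k)  ≈⟨ f.∙-homo k k ⟩
      f k ∙ f k    ≈⟨ ∙-cong fk≈x fk≈x ⟩
      x ∙ x        ≈⟨ x∙x≈ε ⟩
      ε            ≈⟨ f.ε-homo ⟨
      f K.ε        ∎)) , inj₁ (sym fk≈x)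
    ... | inj₂ (k , fk≈sx) = k , inj₂ (f.injective (begin
      f (σ k K.∙ k)        ≈⟨ f.∙-homo (σ k) k ⟩
      f (σ k) ∙ f k        ≈⟨ s-pair k (f k) ⟨
      (s ∙ f k) ∙ (s ∙ f k) ≈⟨ ∙-cong x≈sfk x≈sfk ⟨
      x ∙ x                ≈⟨ x∙x≈ε ⟩
      ε                    ≈⟨ f.ε-homo ⟨
      f K.ε                ∎)) , inj₂ x≈sfk
      where
      x≈sfk : x ≈ s ∙ f k
      x≈sfk = trans (sym (s-cancel x)) (∙-congˡ (sym fk≈sx))

  module _ {p} (P : K.Carrier → Set p) (P-cong : ∀ {x y} → x K.≈ y → P x → P y) (P-ε : P K.ε)
           (P-step : ∀ {k g} → Generator k → P g → P (k K.∙ g)) where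
    private
      InPCosets : Carrier → Set (k₁ ⊔ ℓ ⊔ p)
      InPCosets h = (Σ K.Carrier λ g → h ≈ f g × P g) ⊎ (Σ K.Carrier λ g → h ≈ s ∙ f g × P g)

      inPCosets-cong : ∀ {h h′} → h ≈ h′ → InPCosets h′ → InPCosets h
      inPCosets-cong h≈ (inj₁ (g , h′≈ , Pg)) = inj₁ (g , trans h≈ h′≈ , Pg)
      inPCosets-cong h≈ (inj₂ (g , h′≈ , Pg)) = inj₂ (g , trans h≈ h′≈ , Pg)

      involution-∙ : ∀ {x h} → IsInvolution H x → InPCosets h → InPCosets (x ∙ h)
      involution-∙ x-inv h∈ with involution-shape x-inv | h∈
      ... | k , gen , inj₁ x≈ | inj₁ (g , h≈ , Pg) = inj₁ (k K.∙ g ,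
            trans (∙-cong x≈ h≈) (sym (f.∙-homo k g)) , P-step gen Pg)
      ... | k , gen , inj₁ x≈ | inj₂ (g , h≈ , Pg) = inj₂ (σ k K.∙ g ,
            trans (∙-cong x≈ h≈) (trans (conj-swap k (f g)) (∙-congˡ (sym (f.∙-homo (σ k) g)))) ,
            P-step (σ-generator gen) Pg)
      ... | k , gen , inj₂ x≈ | inj₁ (g , h≈ , Pg) = inj₂ (k K.∙ g ,
            trans (∙-cong x≈ h≈) (trans (assoc s (f k) (f g)) (∙-congˡ (sym (f.∙-homo k g)))) ,
            P-step gen Pg)
      ... | k , gen , inj₂ x≈ | inj₂ (g , h≈ , Pg) = inj₁ (σ k K.∙ g ,
            trans (∙-cong x≈ h≈) (trans (s-pair k (f g)) (sym (f.∙-homo (σ k) g))) ,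
            P-step (σ-generator gen) Pg)

      involution-product-inPCosets : ∀ xs → All (IsInvolution H) xs → InPCosets (foldr _∙_ ε xs)
      involution-product-inPCosets []       []         = inj₁ (K.ε , sym f.ε-homo , P-ε)
      involution-product-inPCosets (x ∷ xs) (ix ∷ ixs) = involution-∙ ix (involution-product-inPCosets xs ixs)

      inPCosets-image⇒P : ∀ {g} → InPCosets (f g) → P g
      inPCosets-image⇒P     (inj₁ (g′ , fg≈ , Pg′)) = P-cong (K.sym (f.injective fg≈)) Pg′
      inPCosets-image⇒P {g} (inj₂ (g′ , fg≈ , _))   = ⊥-elim (s∉ (image-cong
        (sym (x≈z//y s (f g′) (f g) (sym fg≈))) (image-∙ (g , refl) (image-⁻¹ (g′ , refl)))))

    involution-induction : ∀ g → P g
    involution-induction g with xs , involutions , fg≈ ← generated (f g) =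
      inPCosets-image⇒P (inPCosets-cong fg≈ (involution-product-inPCosets xs involutions))

-- The finite quotient R = ℤ/16 ⋊ ℤ/4 and its abelianization Q = (ℤ/4)²

-- (c , j) is the affine map x ↦ c + 5ʲ x of ℤ/16; aᴿ = (1 , 0) and bᴿ = (0 , 1)
-- satisfy the relations of G(m,n) whenever 16 ∣ m and 4 ∣ n.
R : Set
R = Fin 16 × Fin 4

infix 4 _≟ᴿ_
_≟ᴿ_ : (r s : R) → Dec (r ≡ s)
_≟ᴿ_ = ≡-dec _≟ᶠ_ _≟ᶠ_

act : R → Fin 16 → Fin 16
act (c , j) x = (toℕ c + 5 ^ toℕ j * toℕ x) mod 16

infixl 7 _∙ᴿ_
_∙ᴿ_ : R → R → R
(c , j) ∙ᴿ (d , k) = act (c , j) d , (toℕ j + toℕ k) mod 4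

εᴿ : R
εᴿ = # 0 , # 0

infix 8 _⁻¹ᴿ
_⁻¹ᴿ : R → R
(c , j) ⁻¹ᴿ = (15 * 5 ^ toℕ k * toℕ c) mod 16 , k
  where
  k : Fin 4
  k = (4 ∸ toℕ j) mod 4

act-∙ : ∀ r s x → act (r ∙ᴿ s) x ≡ act r (act s x)
act-∙ = decide₃ (λ r s x → act (r ∙ᴿ s) x ≟ᶠ act r (act s x)) ≡.refl

act-injective : ∀ r s → act r (# 0) ≡ act s (# 0) → act r (# 1) ≡ act s (# 1) → r ≡ s
act-injective = decide₂ (λ r s →
  act r (# 0) ≟ᶠ act s (# 0) →-dec act r (# 1) ≟ᶠ act s (# 1) →-dec r ≟ᴿ s) ≡.refl

∙ᴿ-assoc : ∀ r s t → (r ∙ᴿ s) ∙ᴿ t ≡ r ∙ᴿ (s ∙ᴿ t)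
∙ᴿ-assoc r s t = act-injective _ _ (acts-equally (# 0)) (acts-equally (# 1))
  where
  acts-equally : ∀ x → act ((r ∙ᴿ s) ∙ᴿ t) x ≡ act (r ∙ᴿ (s ∙ᴿ t)) x
  acts-equally x = begin
    act ((r ∙ᴿ s) ∙ᴿ t) x   ≡⟨ act-∙ (r ∙ᴿ s) t x ⟩
    act (r ∙ᴿ s) (act t x)  ≡⟨ act-∙ r s (act t x) ⟩
    act r (act s (act t x)) ≡⟨ ≡.cong (act r) (act-∙ s t x) ⟨
    act r (act (s ∙ᴿ t) x)  ≡⟨ act-∙ r (s ∙ᴿ t) x ⟨
    act (r ∙ᴿ (s ∙ᴿ t)) x   ∎
    where open ≡.≡-Reasoning

∙ᴿ-identityˡ : ∀ r → εᴿ ∙ᴿ r ≡ r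
∙ᴿ-identityˡ = decide (λ r → εᴿ ∙ᴿ r ≟ᴿ r) ≡.refl

∙ᴿ-identityʳ : ∀ r → r ∙ᴿ εᴿ ≡ r
∙ᴿ-identityʳ = decide (λ r → r ∙ᴿ εᴿ ≟ᴿ r) ≡.refl

⁻¹ᴿ-inverseˡ : ∀ r → r ⁻¹ᴿ ∙ᴿ r ≡ εᴿ
⁻¹ᴿ-inverseˡ = decide (λ r → r ⁻¹ᴿ ∙ᴿ r ≟ᴿ εᴿ) ≡.refl

⁻¹ᴿ-inverseʳ : ∀ r → r ∙ᴿ r ⁻¹ᴿ ≡ εᴿ
⁻¹ᴿ-inverseʳ = decide (λ r → r ∙ᴿ r ⁻¹ᴿ ≟ᴿ εᴿ) ≡.refl

R-group : Group 0ℓ 0ℓ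
R-group = record
  { Carrier = R
  ; _≈_     = _≡_
  ; _∙_     = _∙ᴿ_
  ; ε       = εᴿ
  ; _⁻¹     = _⁻¹ᴿ
  ; isGroup = record
    { isMonoid = record
      { isSemigroup = record
        { isMagma = record { isEquivalence = ≡.isEquivalence ; ∙-cong = ≡.cong₂ _∙ᴿ_ }
        ; assoc   = ∙ᴿ-assoc
        }
      ; identity = ∙ᴿ-identityˡ , ∙ᴿ-identityʳ
      }
    ; inverse = ⁻¹ᴿ-inverseˡ , ⁻¹ᴿ-inverseʳ
    ; ⁻¹-cong = ≡.cong _⁻¹ᴿ
    }
  }

aᴿ bᴿ : R
aᴿ = # 1 , # 0
bᴿ = # 0 , # 1

word : R → Term
word (c , j) = pow gen-a (toℕ c) · pow gen-b (toℕ j)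

eval-word : ∀ r → eval R-group aᴿ bᴿ (word r) ≡ r
eval-word = decide (λ r → eval R-group aᴿ bᴿ (word r) ≟ᴿ r) ≡.refl

infixl 6 _+₄_
_+₄_ : Fin 4 → Fin 4 → Fin 4
i +₄ j = (toℕ i + toℕ j) mod 4

Q : Set
Q = Fin 4 × Fin 4

infix 4 _≟ᵠ_
_≟ᵠ_ : (x y : Q) → Dec (x ≡ y)
_≟ᵠ_ = ≡-dec _≟ᶠ_ _≟ᶠ_

infixl 6 _+ᵠ_
_+ᵠ_ : Q → Q → Q
(a , b) +ᵠ (c , d) = a +₄ c , b +₄ d

infix 8 -ᵠ_
-ᵠ_ : Q → Q
-ᵠ (a , b) = (4 ∸ toℕ a) mod 4 , (4 ∸ toℕ b) mod 4

0ᵠ e₁ e₂ : Q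
0ᵠ = # 0 , # 0
e₁ = # 1 , # 0
e₂ = # 0 , # 1

+ᵠ-assoc : ∀ x y z → (x +ᵠ y) +ᵠ z ≡ x +ᵠ (y +ᵠ z)
+ᵠ-assoc = decide₃ (λ x y z → (x +ᵠ y) +ᵠ z ≟ᵠ x +ᵠ (y +ᵠ z)) ≡.refl

+ᵠ-comm : ∀ x y → x +ᵠ y ≡ y +ᵠ x
+ᵠ-comm = decide₂ (λ x y → x +ᵠ y ≟ᵠ y +ᵠ x) ≡.refl

+ᵠ-identityˡ : ∀ x → 0ᵠ +ᵠ x ≡ x
+ᵠ-identityˡ = decide (λ x → 0ᵠ +ᵠ x ≟ᵠ x) ≡.refl

+ᵠ-identityʳ : ∀ x → x +ᵠ 0ᵠ ≡ x
+ᵠ-identityʳ = decide (λ x → x +ᵠ 0ᵠ ≟ᵠ x) ≡.refl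

-ᵠ-inverseˡ : ∀ x → -ᵠ x +ᵠ x ≡ 0ᵠ
-ᵠ-inverseˡ = decide (λ x → -ᵠ x +ᵠ x ≟ᵠ 0ᵠ) ≡.refl

-ᵠ-inverseʳ : ∀ x → x +ᵠ -ᵠ x ≡ 0ᵠ
-ᵠ-inverseʳ = decide (λ x → x +ᵠ -ᵠ x ≟ᵠ 0ᵠ) ≡.refl

Q-abelianGroup : AbelianGroup 0ℓ 0ℓ
Q-abelianGroup = record
  { Carrier = Q
  ; _≈_     = _≡_
  ; _∙_     = _+ᵠ_
  ; ε       = 0ᵠ
  ; _⁻¹     = -ᵠ_
  ; isAbelianGroup = record
    { isGroup = record
      { isMonoid = record
        { isSemigroup = record
          { isMagma = record { isEquivalence = ≡.isEquivalence ; ∙-cong = ≡.cong₂ _+ᵠ_ }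
          ; assoc   = +ᵠ-assoc
          }
        ; identity = +ᵠ-identityˡ , +ᵠ-identityʳ
        }
      ; inverse = -ᵠ-inverseˡ , -ᵠ-inverseʳ
      ; ⁻¹-cong = ≡.cong -ᵠ_
      }
    ; comm = +ᵠ-comm
    }
  }

Q-group : Group 0ℓ 0ℓ
Q-group = AbelianGroup.group Q-abelianGroup

+ᵠ-interchange : ∀ w x y z → (w +ᵠ x) +ᵠ (y +ᵠ z) ≡ (w +ᵠ y) +ᵠ (x +ᵠ z)
+ᵠ-interchange = CommutativeSemigroupProperties.interchange (AbelianGroup.commutativeSemigroup Q-abelianGroup)

infixr 7 _·ᵠ_
_·ᵠ_ : Fin 4 → Q → Q
i ·ᵠ (a , b) = (toℕ i * toℕ a) mod 4 , (toℕ i * toℕ b) mod 4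

·ᵠ-distribʳ : ∀ i j x → (i +₄ j) ·ᵠ x ≡ i ·ᵠ x +ᵠ j ·ᵠ x
·ᵠ-distribʳ = decide₃ (λ i j x → (i +₄ j) ·ᵠ x ≟ᵠ i ·ᵠ x +ᵠ j ·ᵠ x) ≡.refl

Matrix : Set
Matrix = Q × Q

apply : Matrix → Q → Q
apply (c₁ , c₂) (v₁ , v₂) = v₁ ·ᵠ c₁ +ᵠ v₂ ·ᵠ c₂

apply-+ : ∀ M u v → apply M (u +ᵠ v) ≡ apply M u +ᵠ apply M v
apply-+ (c₁ , c₂) (u₁ , u₂) (v₁ , v₂) = begin
  (u₁ +₄ v₁) ·ᵠ c₁ +ᵠ (u₂ +₄ v₂) ·ᵠ c₂
    ≡⟨ ≡.cong₂ _+ᵠ_ (·ᵠ-distribʳ u₁ v₁ c₁) (·ᵠ-distribʳ u₂ v₂ c₂) ⟩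
  (u₁ ·ᵠ c₁ +ᵠ v₁ ·ᵠ c₁) +ᵠ (u₂ ·ᵠ c₂ +ᵠ v₂ ·ᵠ c₂)
    ≡⟨ +ᵠ-interchange (u₁ ·ᵠ c₁) (v₁ ·ᵠ c₁) (u₂ ·ᵠ c₂) (v₂ ·ᵠ c₂) ⟩
  (u₁ ·ᵠ c₁ +ᵠ u₂ ·ᵠ c₂) +ᵠ (v₁ ·ᵠ c₁ +ᵠ v₂ ·ᵠ c₂)
    ∎
  where open ≡.≡-Reasoning

apply-isGroupHomomorphism : ∀ M →
  IsGroupHomomorphism (Group.rawGroup Q-group) (Group.rawGroup Q-group) (apply M)
apply-isGroupHomomorphism M = ∙-homo⇒isGroupHomomorphism Q-group Q-group (≡.cong (apply M)) (apply-+ M)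

apply-e₁ : ∀ M → apply M e₁ ≡ proj₁ M
apply-e₁ = decide (λ M → apply M e₁ ≟ᵠ proj₁ M) ≡.refl

apply-e₂ : ∀ M → apply M e₂ ≡ proj₂ M
apply-e₂ = decide (λ M → apply M e₂ ≟ᵠ proj₂ M) ≡.refl

Negates : Matrix → Q → Set
Negates M y = apply M y +ᵠ y ≡ 0ᵠ

negates? : ∀ M y → Dec (Negates M y)
negates? M y = apply M y +ᵠ y ≟ᵠ 0ᵠ

negates-+ : ∀ {M x y} → Negates M x → Negates M y → Negates M (x +ᵠ y)
negates-+ {M} {x} {y} x-neg y-neg = begin
  apply M (x +ᵠ y) +ᵠ (x +ᵠ y)            ≡⟨ ≡.cong (_+ᵠ (x +ᵠ y)) (apply-+ M x y) ⟩
  (apply M x +ᵠ apply M y) +ᵠ (x +ᵠ y)    ≡⟨ +ᵠ-interchange (apply M x) (apply M y) x y ⟩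
  (apply M x +ᵠ x) +ᵠ (apply M y +ᵠ y)    ≡⟨ ≡.cong₂ _+ᵠ_ x-neg y-neg ⟩
  0ᵠ                                      ∎
  where open ≡.≡-Reasoning

reduce₂ : Q → Fin 2 × Fin 2
reduce₂ (a , b) = toℕ a mod 2 , toℕ b mod 2

infix 4 _≡₂_ _≟₂_
_≡₂_ : Q → Q → Set
x ≡₂ y = reduce₂ x ≡ reduce₂ y

_≟₂_ : ∀ x y → Dec (x ≡₂ y)
x ≟₂ y = ≡-dec _≟ᶠ_ _≟ᶠ_ (reduce₂ x) (reduce₂ y)

≡₂-+ˡ : ∀ z x y → x ≡₂ y → z +ᵠ x ≡₂ z +ᵠ y
≡₂-+ˡ = decide₃ (λ z x y → x ≟₂ y →-dec z +ᵠ x ≟₂ z +ᵠ y) ≡.refl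

even-+ˡ : ∀ z x → z ≡₂ 0ᵠ → z +ᵠ x ≡₂ x
even-+ˡ = decide₂ (λ z x → z ≟₂ 0ᵠ →-dec z +ᵠ x ≟₂ x) ≡.refl

-- x ∈ ker(M + 1) + 2Q
NegatedMod2 : Matrix → Q → Set
NegatedMod2 M x = Σ Q λ y → Negates M y × x ≡₂ y

negatedMod2-0 : ∀ M → NegatedMod2 M 0ᵠ
negatedMod2-0 M =
  0ᵠ , ≡.trans (+ᵠ-identityʳ (apply M 0ᵠ)) (IsGroupHomomorphism.ε-homo (apply-isGroupHomomorphism M)) , ≡.refl

negatedMod2-+even : ∀ {M z x} → z ≡₂ 0ᵠ → NegatedMod2 M x → NegatedMod2 M (z +ᵠ x)
negatedMod2-+even {z = z} {x} z-even (y , y-neg , x≡₂y) = y , y-neg , ≡.trans (even-+ˡ z x z-even) x≡₂y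

negatedMod2-+negated : ∀ {M z x} → Negates M z → NegatedMod2 M x → NegatedMod2 M (z +ᵠ x)
negatedMod2-+negated {M} {z} {x} z-neg (y , y-neg , x≡₂y) =
  z +ᵠ y , negates-+ {M} {z} {y} z-neg y-neg , ≡₂-+ˡ z x y x≡₂y

-- Lifts of a basis of Q/2Q generate Q, so M + 1 vanishes on Q.
negates-lifts-of-basis : ∀ M y₁ y₂ → Negates M y₁ → Negates M y₂ → y₁ ≡₂ e₁ → y₂ ≡₂ e₂ →
                         M ≡ (-ᵠ e₁ , -ᵠ e₂)
negates-lifts-of-basis = decide₃ (λ M y₁ y₂ →
  negates? M y₁ →-dec negates? M y₂ →-dec y₁ ≟₂ e₁ →-dec y₂ ≟₂ e₂ →-dec M ≟ᵐ (-ᵠ e₁ , -ᵠ e₂)) ≡.refl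
  where
  _≟ᵐ_ : (M N : Matrix) → Dec (M ≡ N)
  _≟ᵐ_ = ≡-dec _≟ᵠ_ _≟ᵠ_

π : R → Q
π (c , j) = toℕ c mod 4 , j

π-∙ : ∀ r s → π (r ∙ᴿ s) ≡ π r +ᵠ π s
π-∙ = decide₂ (λ r s → π (r ∙ᴿ s) ≟ᵠ π r +ᵠ π s) ≡.refl

π-isGroupHomomorphism : IsGroupHomomorphism (Group.rawGroup R-group) (Group.rawGroup Q-group) π
π-isGroupHomomorphism = ∙-homo⇒isGroupHomomorphism R-group Q-group (≡.cong π) π-∙

involution⇒π-even : ∀ r → r ∙ᴿ r ≡ εᴿ → π r ≡₂ 0ᵠ
involution⇒π-even = decide (λ r → r ∙ᴿ r ≟ᴿ εᴿ →-dec π r ≟₂ 0ᵠ) ≡.refl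

commutes-with-generators⇒π≡0 : ∀ r → r ∙ᴿ aᴿ ≡ aᴿ ∙ᴿ r → r ∙ᴿ bᴿ ≡ bᴿ ∙ᴿ r → π r ≡ 0ᵠ
commutes-with-generators⇒π≡0 = decide (λ r →
  r ∙ᴿ aᴿ ≟ᴿ aᴿ ∙ᴿ r →-dec r ∙ᴿ bᴿ ≟ᴿ bᴿ ∙ᴿ r →-dec π r ≟ᵠ 0ᵠ) ≡.refl

-- For such x and y one has [y, x] = x⁻⁴, while x has order 16.
relation-fails-on-negated-generators : ∀ x y → π x ≡ -ᵠ e₁ → π y ≡ -ᵠ e₂ →
  ¬ eval R-group x y (comm gen-b gen-a) ≡ eval R-group x y (pow gen-a 4)
relation-fails-on-negated-generators = decide₂ (λ x y →
  π x ≟ᵠ -ᵠ e₁ →-dec π y ≟ᵠ -ᵠ e₂ →-dec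
  ¬? (eval R-group x y (comm gen-b gen-a) ≟ᴿ eval R-group x y (pow gen-a 4))) ≡.refl

record CoversR {k₁ k₂} (K : Group k₁ k₂) : Set (k₁ ⊔ k₂) where
  open Group K
  field
    a b                   : Carrier
    relation              : eval K a b (comm gen-b gen-a) ≈ eval K a b (pow gen-a 4)
    generated             : GeneratedModuloCentre K a b
    ρ                     : Carrier → R
    ρ-isGroupHomomorphism : IsGroupHomomorphism rawGroup (Group.rawGroup R-group) ρ
    ρ-a                   : ρ a ≡ aᴿ
    ρ-b                   : ρ b ≡ bᴿ

module _ {k₁ k₂ c ℓ} {K : Group k₁ k₂} (covers : CoversR K) {H : Group c ℓ}
         (generated-H : GeneratedByInvolutions H) (embedding : EmbedsWithIndex2 K H) where
  private
    module K = Group K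
    open CoversR covers
    open Index2 {K = K} {H = H} generated-H embedding
    module ρ = IsGroupHomomorphism ρ-isGroupHomomorphism

    q : K.Carrier → Q
    q = π ∘ ρ

    q-isGroupHomomorphism : IsGroupHomomorphism K.rawGroup (Group.rawGroup Q-group) q
    q-isGroupHomomorphism = Composition.isGroupHomomorphism ≡.trans ρ-isGroupHomomorphism π-isGroupHomomorphism
    module q = IsGroupHomomorphism q-isGroupHomomorphism

    ψ : K.Carrier → Q
    ψ = q ∘ σ

    ψ-isGroupHomomorphism : IsGroupHomomorphism K.rawGroup (Group.rawGroup Q-group) ψ
    ψ-isGroupHomomorphism = Composition.isGroupHomomorphism ≡.trans σ-isGroupHomomorphism q-isGroupHomomorphism

    M : Matrix
    M = ψ a , ψ b

    q-central : ∀ z → Central K z → q z ≡ 0ᵠ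
    q-central z z-central = commutes-with-generators⇒π≡0 (ρ z) (commutes ρ-a) (commutes ρ-b)
      where
      commutes : ∀ {g r} → ρ g ≡ r → ρ z ∙ᴿ r ≡ r ∙ᴿ ρ z
      commutes {g} ≡.refl = ≡.trans (≡.sym (ρ.homo z g)) (≡.trans (ρ.⟦⟧-cong (z-central g)) (ρ.homo g z))

    σ-central : ∀ z → Central K z → Central K (σ z)
    σ-central = involutive-homo-central {K = K} σ-isGroupHomomorphism σ-involutive

    ψ≡apply-M∘q : ∀ g → ψ g ≡ apply M (q g)
    ψ≡apply-M∘q = homomorphisms-agree {K = K} {X = Q-group} ψ-isGroupHomomorphism
      (Composition.isGroupHomomorphism ≡.trans q-isGroupHomomorphism (apply-isGroupHomomorphism M))
      generated
      (≡.sym (≡.trans (≡.cong (apply M ∘ π) ρ-a) (apply-e₁ M)))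
      (≡.sym (≡.trans (≡.cong (apply M ∘ π) ρ-b) (apply-e₂ M)))
      λ z z-central → begin
        ψ z            ≡⟨ q-central (σ z) (σ-central z z-central) ⟩
        0ᵠ             ≡⟨ IsGroupHomomorphism.ε-homo (apply-isGroupHomomorphism M) ⟨
        apply M 0ᵠ     ≡⟨ ≡.cong (apply M) (q-central z z-central) ⟨
        apply M (q z)  ∎
      where open ≡.≡-Reasoning

    q-negatedMod2 : ∀ g → NegatedMod2 M (q g)
    q-negatedMod2 = involution-induction (NegatedMod2 M ∘ q)
      (λ g≈h → ≡.subst (NegatedMod2 M) (q.⟦⟧-cong g≈h))
      (≡.subst (NegatedMod2 M) (≡.sym q.ε-homo) (negatedMod2-0 M))
      (λ {k} {g} gen → ≡.subst (NegatedMod2 M) (≡.sym (q.homo k g)) ∘ negatedMod2-+generator gen)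
      where
      negatedMod2-+generator : ∀ {k x} → Generator k → NegatedMod2 M x → NegatedMod2 M (q k +ᵠ x)
      negatedMod2-+generator {k} {x} (inj₁ k∙k≈ε) = negatedMod2-+even {M} {q k} {x}
        (involution⇒π-even (ρ k) (≡.trans (≡.sym (ρ.homo k k)) (≡.trans (ρ.⟦⟧-cong k∙k≈ε) ρ.ε-homo)))
      negatedMod2-+generator {k} {x} (inj₂ σk∙k≈ε) = negatedMod2-+negated {M} {q k} {x} (begin
        apply M (q k) +ᵠ q k  ≡⟨ ≡.cong (_+ᵠ q k) (ψ≡apply-M∘q k) ⟨
        ψ k +ᵠ q k            ≡⟨ q.homo (σ k) k ⟨
        q (σ k K.∙ k)         ≡⟨ q.⟦⟧-cong σk∙k≈ε ⟩
        q K.ε                 ≡⟨ q.ε-homo ⟩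
        0ᵠ                    ∎)
        where open ≡.≡-Reasoning

    M≡-1 : M ≡ (-ᵠ e₁ , -ᵠ e₂)
    M≡-1 = from-lifts (q-negatedMod2 a) (q-negatedMod2 b)
      where
      from-lifts : NegatedMod2 M (q a) → NegatedMod2 M (q b) → M ≡ (-ᵠ e₁ , -ᵠ e₂)
      from-lifts (y₁ , y₁-neg , a≡₂y₁) (y₂ , y₂-neg , b≡₂y₂) =
        negates-lifts-of-basis M y₁ y₂ y₁-neg y₂-neg
          (≡.trans (≡.sym a≡₂y₁) (≡.cong (reduce₂ ∘ π) ρ-a))
          (≡.trans (≡.sym b≡₂y₂) (≡.cong (reduce₂ ∘ π) ρ-b))

    ρ∘σ-isGroupHomomorphism : IsGroupHomomorphism K.rawGroup (Group.rawGroup R-group) (ρ ∘ σ)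
    ρ∘σ-isGroupHomomorphism = Composition.isGroupHomomorphism ≡.trans σ-isGroupHomomorphism ρ-isGroupHomomorphism

    relation-at-σ : eval R-group (ρ (σ a)) (ρ (σ b)) (comm gen-b gen-a) ≡
                    eval R-group (ρ (σ a)) (ρ (σ b)) (pow gen-a 4)
    relation-at-σ = ≡.trans (≡.sym (ρ∘σ-eval (comm gen-b gen-a)))
      (≡.trans (IsGroupHomomorphism.⟦⟧-cong ρ∘σ-isGroupHomomorphism relation) (ρ∘σ-eval (pow gen-a 4)))
      where
      ρ∘σ-eval : ∀ w → ρ (σ (eval K a b w)) ≡ eval R-group (ρ (σ a)) (ρ (σ b)) w
      ρ∘σ-eval = eval-homo {G = K} {H = R-group} ρ∘σ-isGroupHomomorphism a b

  no-index2-embedding : ⊥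
  no-index2-embedding = relation-fails-on-negated-generators (ρ (σ a)) (ρ (σ b))
    (≡.cong proj₁ M≡-1) (≡.cong proj₂ M≡-1) relation-at-σ

coversR⇒notIndex2 : ∀ {k₁ k₂} {K : Group k₁ k₂} → CoversR K →
                    ∀ c ℓ → NotIndex2InInvolutionGenerated c ℓ K
coversR⇒notIndex2 covers c ℓ H generated embedding = no-index2-embedding covers {H = H} generated embedding

G-coversR : ∀ {m n} → 16 ∣ m → 4 ∣ n → CoversR G[ m , n ]
G-coversR {m} {n} (divides d ≡.refl) (divides e ≡.refl) = record
  { a                     = gen-a
  ; b                     = gen-b
  ; relation              = ~-trans (eval-generators _) (~-trans rel-ba (~-sym (eval-generators _)))
  ; generated             = λ g → g , one , (λ h → ~-trans (~-idˡ h) (~-sym (~-idʳ h))) ,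
                                    ~-sym (~-trans (~-idʳ _) (eval-generators g))
  ; ρ                     = eval R-group aᴿ bᴿ
  ; ρ-isGroupHomomorphism = eval-isGroupHomomorphism R-group
      (eval-pow-*-ε R-group {aᴿ} {bᴿ} {gen-a} {16} ≡.refl d)
      (eval-pow-*-ε R-group {aᴿ} {bᴿ} {gen-b} {4} ≡.refl e)
      ≡.refl
  ; ρ-a                   = ≡.refl
  ; ρ-b                   = ≡.refl
  }
  where open Presentation (d * 16) (e * 4)

module _ (E : AbelianGroup 0ℓ 0ℓ) where
  private
    module E = AbelianGroup E
    R×E : Group 0ℓ 0ℓ
    R×E = DirectProduct.group R-group E.group
    module R×E = Group R×E

    ι : R → R×E.Carrier
    ι r = r , E.ε

    ι-isGroupHomomorphism : IsGroupHomomorphism (Group.rawGroup R-group) R×E.rawGroup ι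
    ι-isGroupHomomorphism = ∙-homo⇒isGroupHomomorphism R-group R×E
      (λ r≡s → r≡s , E.refl) (λ _ _ → ≡.refl , E.sym (E.identityˡ E.ε))

    eval-ι : ∀ w → eval R×E (ι aᴿ) (ι bᴿ) w R×E.≈ ι (eval R-group aᴿ bᴿ w)
    eval-ι w = R×E.sym (eval-homo ι-isGroupHomomorphism aᴿ bᴿ w)

    ε×-central : ∀ x → Central R×E (εᴿ , x)
    ε×-central x (r , y) = ≡.trans (∙ᴿ-identityˡ r) (≡.sym (∙ᴿ-identityʳ r)) , E.comm x y

  R×-coversR : CoversR R×E
  R×-coversR = record
    { a                     = ι aᴿ
    ; b                     = ι bᴿ
    ; relation              = R×E.trans (eval-ι (comm gen-b gen-a)) (R×E.sym (eval-ι (pow gen-a 4)))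
    ; generated             = λ (r , x) → word r , (εᴿ , x) , ε×-central x ,
        R×E.trans (R×E.sym (∙ᴿ-identityʳ r , E.identityˡ x))
                  (R×E.∙-congʳ (R×E.trans (≡.sym (eval-word r) , E.refl) (R×E.sym (eval-ι (word r)))))
    ; ρ                     = proj₁
    ; ρ-isGroupHomomorphism = ∙-homo⇒isGroupHomomorphism R×E R-group proj₁ (λ _ _ → ≡.refl)
    ; ρ-a                   = ≡.refl
    ; ρ-b                   = ≡.refl
    }

HasOrder-trivial : HasOrder (Terminal.group {0ℓ} {0ℓ}) 1
HasOrder-trivial = (λ _ → _) , (λ { Fin.zero Fin.zero _ → ≡.refl }) , (λ _ → Fin.zero , _)

ℤ₂ : AbelianGroup 0ℓ 0ℓ
ℤ₂ = CommutativeRing.+-abelianGroup xor-∧-commutativeRing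

ℤ₂^ : ℕ → AbelianGroup 0ℓ 0ℓ
ℤ₂^ zero    = Terminal.abelianGroup
ℤ₂^ (suc N) = DirectProduct.abelianGroup ℤ₂ (ℤ₂^ N)

HasOrder-ℤ₂^ : ∀ N → HasOrder (AbelianGroup.group (ℤ₂^ N)) (2 ^ N)
HasOrder-ℤ₂^ zero    = HasOrder-trivial
HasOrder-ℤ₂^ (suc N) = HasOrder-× (AbelianGroup.group ℤ₂) (AbelianGroup.group (ℤ₂^ N))
  (HasOrder-↔ (AbelianGroup.group ℤ₂) 2↔Bool id) (HasOrder-ℤ₂^ N)

R×ℤ₂^ : ℕ → Group 0ℓ 0ℓ
R×ℤ₂^ N = DirectProduct.group R-group (AbelianGroup.group (ℤ₂^ N))

HasOrder-R×ℤ₂^ : ∀ N → HasOrder (R×ℤ₂^ N) (2 ^ (6 + N))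
HasOrder-R×ℤ₂^ N = ≡.subst (HasOrder (R×ℤ₂^ N)) (≡.sym (^-distribˡ-+-* 2 6 N))
  (HasOrder-× R-group (AbelianGroup.group (ℤ₂^ N)) (HasOrder-↔ R-group *↔× id) (HasOrder-ℤ₂^ N))

mainTheorem1 : ∀ {c ℓ} →
    ((m n : ℕ) → IsPowerOf2 m → IsPowerOf2 n → 16 ≤ m → 4 ≤ n → m ≤ 4 * n →
      NotIndex2InInvolutionGenerated c ℓ G[ m , n ])
    ×
    ((N : ℕ) → Σ ℕ λ k → N ≤ k × Σ (Group 0ℓ 0ℓ) λ K →
      HasOrder K (2 ^ k) × NotIndex2InInvolutionGenerated c ℓ K)
mainTheorem1 {c} {ℓ} =
  (λ m n m-pow n-pow 16≤m 4≤n _ →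
    coversR⇒notIndex2 (G-coversR (powerOf2-≤⇒∣ 4 m-pow 16≤m) (powerOf2-≤⇒∣ 2 n-pow 4≤n)) c ℓ) ,
  (λ N → 6 + N , m≤n+m N 6 , R×ℤ₂^ N ,
    HasOrder-R×ℤ₂^ N , coversR⇒notIndex2 (R×-coversR (ℤ₂^ N)) c ℓ)
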